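{- Let $\mathfrak T\subseteq\mathcal P(\Delta)$ be a structure with $\mathfrak L\subseteq\mathfrak T$, and let $M$ be a non-deterministic $\lambda$-term. If $\mathcal T(M)\in(\uparrow\mathfrak T)^\perp$, then $M$ is strongly normalizable. In particular this holds for $\mathfrak T\in\{\mathfrak L,\mathfrak B\}$.
   Context: Non-deterministic $\lambda$-terms are given by $M::=x\mid\lambda x.M\mid (M)N\mid M+N$, taken up to $\alpha$-equivalence and the identities $M+N=N+M$, $(M+N)+P=M+(N+P)$, $\lambda x.(M+N)=\lambda x.M+\lambda x.N$, $(M+N)P=(M)P+(N)P$. $\beta$-reduction is the contextual closure of $(\lambda x.M)N\to_\beta M[N/x]$. The term $M$ is strongly normalizable if it has no infinite $\beta$-reduction sequence. Resource terms ($\Delta$) are given by $s::=x\mid\lambda x.s\mid\langle s\rangle\bar t$, with bags $\bar t$ finite multisets of resource terms; $a^!$ is the set of bags with elements in $a$. The Taylor support $\mathcal T(M)$ is defined by: - $\mathcal T(x)=\{x\}$; - $\mathcal T(\lambda x.M)=\{\lambda x.s:s\in\mathcal T(M)\}$; - $\mathcal T((M)N)=\{\langle s\rangle\bar t:s\in\mathcal T(M),\bar t\in\mathcal T(N)^!\}$; - $\mathcal T(M+N)=\mathcal T(M)\cup\mathcal T(N)$. Resource reduction $\to_r$ acts on finite formal sums of resource terms with natural coefficients. It is generated by $\langle\lambda x.t\rangle[s_1,\dots,s_n]\to_r\sum_{f\in S_n}t[s_{f(1)}/x_1,\dots,s_{f(n)}/x_n]$ if $x_1,\dots,x_n$ are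 exactly the free occurrences of $x$ in $t$ (and $\to_r 0$ if the number of free occurrences differs from $n$). It is closed under the term constructors (including inside bags, extended linearly) and under linearity ($\alpha t+b\to_r\alpha a+b$ whenever $t\to_r a$, $\alpha\neq 0$). Write $t\ge s$ if $t\to_r^*a$ with $s$ in the support of $a$. Let $\uparrow a=\{t:\exists s\in a,\ t\ge s\}$ and, for a structure $\mathfrak T\subseteq\mathcal P(\Delta)$, $\uparrow\mathfrak T=\{\uparrow a:a\in\mathfrak T\}$. For a structure $\mathfrak S$, $\mathfrak S^\perp=\{a\subseteq\Delta:\forall a'\in\mathfrak S,\ a\cap a'\text{ finite}\}$. A resource term is linear if every bag occurring in it has cardinality $1$. $\mathfrak L$ is the set of all sets of linear resource terms. $\mathfrak B$ is the set of all $a\subseteq\Delta$ such that some $n$ bounds the cardinality of every bag in every term of $a$. -}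

module Defs where

open import Data.Nat using (ℕ; zero; suc; _+_; _≤_; _<ᵇ_; _≡ᵇ_; pred)
open import Data.Bool using (if_then_else_)
open import Data.List using (List; []; _∷_; [_]; _++_; map; concat; concatMap; replicate; length)
open import Data.List.Relation.Unary.All using (All)
open import Data.List.Membership.Propositional using (_∈_)
open import Data.List.Relation.Binary.Permutation.Propositional using (_↭_)
open import Data.Product using (Σ; ∃; _×_; _,_; proj₁; proj₂)
open import Data.Empty using (⊥)
open import Relation.Nullary using (¬_)
open import Relation.Binary.Construct.Closure.ReflexiveTransitive using (Star)

-- Non-deterministic λ-terms (de Bruijn indices, so α-equivalence is ≡)

infixl 6 _⊕_

data Tm : Set where
  var : ℕ → Tm
  lam : Tm → Tm
  app : Tm → Tm → Tm
  _⊕_ : Tm → Tm → Tm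

wkT : ℕ → Tm → Tm
wkT c (var i) = if i <ᵇ c then var i else var (suc i)
wkT c (lam M) = lam (wkT (suc c) M)
wkT c (app M N) = app (wkT c M) (wkT c N)
wkT c (M ⊕ N) = wkT c M ⊕ wkT c N

wkTn : ℕ → Tm → Tm
wkTn zero N = N
wkTn (suc k) N = wkT 0 (wkTn k N)

substT : ℕ → Tm → Tm → Tm
substT k N (var i) =
  if i ≡ᵇ k then wkTn k N else (if i <ᵇ k then var i else var (pred i))
substT k N (lam M) = lam (substT (suc k) N M)
substT k N (app M P) = app (substT k N M) (substT k N P)
substT k N (M ⊕ P) = substT k N M ⊕ substT k N P

infix 4 _≃_
data _≃_ : Tm → Tm → Set where
  ≃-refl  : ∀ {M} → M ≃ M
  ≃-sym   : ∀ {M N} → M ≃ N → N ≃ M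
  ≃-trans : ∀ {M N P} → M ≃ N → N ≃ P → M ≃ P
  ≃-lam   : ∀ {M M'} → M ≃ M' → lam M ≃ lam M'
  ≃-app   : ∀ {M M' N N'} → M ≃ M' → N ≃ N' → app M N ≃ app M' N'
  ≃-sum   : ∀ {M M' N N'} → M ≃ M' → N ≃ N' → M ⊕ N ≃ M' ⊕ N'
  comm    : ∀ {M N} → M ⊕ N ≃ N ⊕ M
  assoc   : ∀ {M N P} → (M ⊕ N) ⊕ P ≃ M ⊕ (N ⊕ P)
  lam-sum : ∀ {M N} → lam (M ⊕ N) ≃ lam M ⊕ lam N
  app-sum : ∀ {M N P} → app (M ⊕ N) P ≃ app M P ⊕ app N P

infix 4 _→β_
data _→β_ : Tm → Tm → Set where
  beta : ∀ {M N} → app (lam M) N →β substT 0 N M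
  lamβ : ∀ {M M'} → M →β M' → lam M →β lam M'
  appL : ∀ {M M' N} → M →β M' → app M N →β app M' N
  appR : ∀ {M N N'} → N →β N' → app M N →β app M N'
  sumL : ∀ {M M' N} → M →β M' → M ⊕ N →β M' ⊕ N
  sumR : ∀ {M N N'} → N →β N' → M ⊕ N →β M ⊕ N'

infix 4 _⇒β_
_⇒β_ : Tm → Tm → Set
M ⇒β N = Σ Tm λ M' → Σ Tm λ N' → M ≃ M' × M' →β N' × N' ≃ N

StronglyNormalizable : Tm → Set
StronglyNormalizable M =
  ¬ (Σ (ℕ → Tm) λ f → (f 0 ≃ M) × (∀ i → f i ⇒β f (suc i)))

-- Resource terms (de Bruijn; bags as lists, taken up to permutation via ≈)

data Res : Set where
  var : ℕ → Res
  lam : Res → Res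
  app : Res → List Res → Res

infix 4 _≈_ _≈ᵇ_
data _≈_ : Res → Res → Set
data _≈ᵇ_ : List Res → List Res → Set

data _≈_ where
  var : ∀ {i} → var i ≈ var i
  lam : ∀ {s t} → s ≈ t → lam s ≈ lam t
  app : ∀ {s t bs cs} → s ≈ t → bs ≈ᵇ cs → app s bs ≈ app t cs

data _≈ᵇ_ where
  []    : [] ≈ᵇ []
  _∷_   : ∀ {s t bs cs} → s ≈ t → bs ≈ᵇ cs → (s ∷ bs) ≈ᵇ (t ∷ cs)
  swap  : ∀ {s t bs} → (s ∷ t ∷ bs) ≈ᵇ (t ∷ s ∷ bs)
  trans : ∀ {bs cs ds} → bs ≈ᵇ cs → cs ≈ᵇ ds → bs ≈ᵇ ds

wkR  : ℕ → Res → Res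
wkRs : ℕ → List Res → List Res
wkR c (var i) = if i <ᵇ c then var i else var (suc i)
wkR c (lam s) = lam (wkR (suc c) s)
wkR c (app s bs) = app (wkR c s) (wkRs c bs)
wkRs c [] = []
wkRs c (b ∷ bs) = wkR c b ∷ wkRs c bs

wkRn : ℕ → Res → Res
wkRn zero s = s
wkRn (suc k) s = wkR 0 (wkRn k s)

occ  : ℕ → Res → ℕ
occs : ℕ → List Res → ℕ
occ k (var i) = if i ≡ᵇ k then 1 else 0
occ k (lam s) = occ (suc k) s
occ k (app s bs) = occ k s + occs k bs
occs k [] = 0
occs k (b ∷ bs) = occ k b + occs k bs

-- linear substitution: the successive free occurrences of index k are
-- replaced by the successive elements of the list (the binder k is removed);
-- returns the result and the unused elements
lsub  : ℕ → Res → List Res → Res × List Res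
lsubs : ℕ → List Res → List Res → List Res × List Res
lsub k (var i) ss with i ≡ᵇ k
lsub k (var i) [] | Data.Bool.true = var i , []
lsub k (var i) (s ∷ ss) | Data.Bool.true = wkRn k s , ss
... | Data.Bool.false = (if i <ᵇ k then var i else var (pred i)) , ss
lsub k (lam s) ss with lsub (suc k) s ss
... | (s' , ss') = lam s' , ss'
lsub k (app s bs) ss with lsub k s ss
... | (s' , ss') with lsubs k bs ss'
...   | (bs' , ss'') = app s' bs' , ss''
lsubs k [] ss = [] , ss
lsubs k (b ∷ bs) ss with lsub k b ss
... | (b' , ss') with lsubs k bs ss'
...   | (bs' , ss'') = (b' ∷ bs') , ss''

-- all permutations of a list (the n! orderings, with multiplicity)
insertions : {A : Set} → A → List A → List (List A)
insertions x [] = [ [ x ] ]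
insertions x (y ∷ ys) = (x ∷ y ∷ ys) ∷ map (y ∷_) (insertions x ys)

perms : {A : Set} → List A → List (List A)
perms [] = [ [] ]
perms (x ∷ xs) = concatMap (insertions x) (perms xs)

-- finite formal sums of resource terms with natural coefficients,
-- represented as lists (a term occurring k times has coefficient k)
Sum : Set
Sum = List Res

βres : Res → List Res → Sum
βres t bs = if occ 0 t ≡ᵇ length bs
            then map (λ ss → proj₁ (lsub 0 t ss)) (perms bs)
            else []

infix 4 _→₁_
data _→₁_ : Res → Sum → Set where
  βr   : ∀ {t bs} → app (lam t) bs →₁ βres t bs
  lamr : ∀ {t a} → t →₁ a → lam t →₁ map lam a
  appL : ∀ {t a bs} → t →₁ a → app t bs →₁ map (λ u → app u bs) a
  bagr : ∀ {t s a bs cs} → s →₁ a →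
         app t (bs ++ s ∷ cs) →₁ map (λ u → app t (bs ++ u ∷ cs)) a

-- linearity: α t + b →r α a + b  (α ≠ 0), sums taken up to reordering
infix 4 _→r_
data _→r_ : Sum → Sum → Set where
  step : ∀ {A b t a} (α : ℕ) → A ↭ (replicate (suc α) t ++ b) → t →₁ a →
         A →r (concat (replicate (suc α) a) ++ b)

InSupport : Res → Sum → Set
InSupport s a = Σ Res λ s' → s' ∈ a × s' ≈ s

infix 4 _≥r_
_≥r_ : Res → Res → Set
t ≥r s = Σ Sum λ a → Star _→r_ [ t ] a × InSupport s a

-- sets of resource terms are predicates
Up : (Res → Set) → (Res → Set)
Up a t = Σ Res λ s → a s × t ≥r s

Finite : (Res → Set) → Set
Finite P = Σ (List Res) λ xs → ∀ t → P t → t ∈ xs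

data 𝒯 : Tm → Res → Set where
  var  : ∀ {i} → 𝒯 (var i) (var i)
  lam  : ∀ {M s} → 𝒯 M s → 𝒯 (lam M) (lam s)
  app  : ∀ {M N s bs} → 𝒯 M s → All (𝒯 N) bs → 𝒯 (app M N) (app s bs)
  sumL : ∀ {M N s} → 𝒯 M s → 𝒯 (M ⊕ N) s
  sumR : ∀ {M N s} → 𝒯 N s → 𝒯 (M ⊕ N) s

Structure : Set₁
Structure = (Res → Set) → Set

-- a ∈ (↑𝔗)^⊥  (↑𝔗 = { ↑a' : a' ∈ 𝔗 })
InPerpUp : Structure → (Res → Set) → Set₁
InPerpUp 𝔗 a = ∀ a' → 𝔗 a' → Finite (λ t → a t × Up a' t)

data Linear : Res → Set where
  var : ∀ {i} → Linear (var i)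
  lam : ∀ {s} → Linear s → Linear (lam s)
  app : ∀ {s t} → Linear s → Linear t → Linear (app s [ t ])

𝔏 : Structure
𝔏 a = ∀ t → a t → Linear t

data Bounded (n : ℕ) : Res → Set where
  var : ∀ {i} → Bounded n (var i)
  lam : ∀ {s} → Bounded n s → Bounded n (lam s)
  app : ∀ {s bs} → Bounded n s → All (Bounded n) bs → length bs ≤ n →
        Bounded n (app s bs)

𝔅 : Structure
𝔅 a = Σ ℕ λ n → ∀ t → a t → Bounded n t

_⊆ˢ_ : Structure → Structure → Set₁
𝔖 ⊆ˢ 𝔗 = ∀ a → 𝔖 a → 𝔗 a

-- A β-step M → N is simulated on Taylor supports: every element of 𝒯(N) is
-- a resource reduct of an element of 𝒯(M).  Since being above a linear term
-- is an upward-closed property, the elements of 𝒯(M) above linear terms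
-- (finitely many, by orthogonality to the set of all linear terms) cover,
-- through their reducts, those of 𝒯(N).  Each element of size n has either
-- a single reduct of size at most n, or at most n! reducts of size below n,
-- and the latter happens for some linear element.  So the weight
-- Σ ω(size) of the covering elements, where ω(n+1) exceeds (n+1)! ω(n),
-- strictly decreases along any reduction sequence from M.

module Submission where

open import Defs
open import Data.Bool using (true; false; if_then_else_)
open import Data.Empty using (⊥-elim)
open import Data.List using (List; []; _∷_; [_]; _++_; map; concat; concatMap; replicate; length)
open import Data.List.Membership.Propositional using (_∈_; find; lose)
open import Data.List.Membership.Propositional.Properties
  using (∈-map⁺; ∈-map⁻; ∈-++⁺ˡ; ∈-++⁺ʳ; ∈-∃++; ∈-concatMap⁺; ∈-concatMap⁻)
open import Data.List.Properties
  using (++-assoc; ++-identityʳ; length-++; length-map; map-∘; map-++; map-replicate;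
         concat-map; concatMap-cong; concatMap-map; map-concatMap)
open import Data.List.Relation.Binary.Permutation.Propositional
  using (_↭_; ↭-refl; ↭-sym; ↭-trans; ↭-reflexive; prep; swap)
import Data.List.Relation.Binary.Permutation.Propositional as ↭
open import Data.List.Relation.Binary.Permutation.Propositional.Properties
  using (↭-length; ++⁺ˡ; ++⁺ʳ; shifts; map⁺; ∈-resp-↭)
open import Data.List.Relation.Binary.Pointwise using (Pointwise; []; _∷_)
open import Data.List.Relation.Unary.All using (All; []; _∷_)
import Data.List.Relation.Unary.All as All
import Data.List.Relation.Unary.All.Properties as All
open import Data.List.Relation.Unary.Any using (here; there)
open import Data.Maybe using (Maybe; just; nothing)
open import Data.Nat using (ℕ; zero; suc; _+_; _*_; _≤_; _<_; _<ᵇ_; _≡ᵇ_; pred; z≤n; s≤s; _!; _≟_)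
open import Data.Nat.Induction using (<-wellFounded)
open import Data.Nat.ListAction using (sum)
open import Data.Nat.ListAction.Properties using (sum-++; sum-↭)
open import Data.Nat.Properties
open import Algebra.Properties.CommutativeSemigroup +-commutativeSemigroup using (x∙yz≈y∙xz)
open import Data.Product using (Σ; ∃; _×_; _,_; proj₁; proj₂)
open import Data.Sum using (_⊎_; inj₁; inj₂)
open import Function using (_∘_; id)
open import Induction.InfiniteDescent using (InfiniteDescendingSequence; descent∧wf⇒empty)
open import Relation.Binary.Construct.Closure.ReflexiveTransitive using (Star; ε; _◅_; _◅◅_)
open import Relation.Binary.Core using (_Preserves_⟶_)
open import Relation.Binary.PropositionalEquality hiding ([_]) renaming (trans to ≡-trans)
open import Relation.Nullary using (¬_; yes; no)

private variable
  A B : Set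

module _ (f : A → List B) where

  ∈-concatMap⁺′ : ∀ {xs x y} → x ∈ xs → y ∈ f x → y ∈ concatMap f xs
  ∈-concatMap⁺′ x∈xs y∈fx = ∈-concatMap⁺ f (lose x∈xs y∈fx)

  ∈-concatMap⁻′ : ∀ xs {y} → y ∈ concatMap f xs → ∃ λ x → x ∈ xs × y ∈ f x
  ∈-concatMap⁻′ xs y∈ = find (∈-concatMap⁻ f {xs} y∈)

  length-concatMap-≤ : ∀ xs n → (∀ x → x ∈ xs → length (f x) ≤ n) →
                       length (concatMap f xs) ≤ length xs * n
  length-concatMap-≤ [] n bound = z≤n
  length-concatMap-≤ (x ∷ xs) n bound = begin
    length (f x ++ concatMap f xs)        ≡⟨ length-++ (f x) ⟩
    length (f x) + length (concatMap f xs) ≤⟨ +-mono-≤ (bound x (here refl))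
                                                 (length-concatMap-≤ xs n (λ y → bound y ∘ there)) ⟩
    n + length xs * n                      ∎
    where open ≤-Reasoning

products : List (List A) → List (List A)
products [] = [ [] ]
products (xs ∷ xss) = concatMap (λ x → map (x ∷_) (products xss)) xs

∈-products⁺ : ∀ {ys : List A} {xss} → Pointwise _∈_ ys xss → ys ∈ products xss
∈-products⁺ [] = here refl
∈-products⁺ {ys = y ∷ ys} (y∈xs ∷ ys∈xss) =
  ∈-concatMap⁺′ _ y∈xs (∈-map⁺ (y ∷_) (∈-products⁺ ys∈xss))

∈-products⁻ : ∀ {ys : List A} xss → ys ∈ products xss → Pointwise _∈_ ys xss
∈-products⁻ [] (here refl) = []
∈-products⁻ (xs ∷ xss) ys∈ with ∈-concatMap⁻′ _ xs ys∈
... | x , x∈xs , m with ∈-map⁻ (x ∷_) m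
...   | zs , zs∈ , refl = x∈xs ∷ ∈-products⁻ xss zs∈

insertions-↭ : ∀ (x : A) ys {zs} → zs ∈ insertions x ys → zs ↭ x ∷ ys
insertions-↭ x [] (here refl) = ↭-refl
insertions-↭ x (y ∷ ys) (here refl) = ↭-refl
insertions-↭ x (y ∷ ys) (there m) with ∈-map⁻ (y ∷_) m
... | zs , m' , refl = ↭-trans (prep y (insertions-↭ x ys m')) (swap y x ↭-refl)

perms-↭ : ∀ (xs : List A) {ys} → ys ∈ perms xs → ys ↭ xs
perms-↭ [] (here refl) = ↭-refl
perms-↭ (x ∷ xs) m with ∈-concatMap⁻′ (insertions x) (perms xs) m
... | zs , zs∈ , m' = ↭-trans (insertions-↭ x zs m') (prep x (perms-↭ xs zs∈))

∈-perms : ∀ (xs : List A) → xs ∈ perms xs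
∈-perms [] = here refl
∈-perms (x ∷ []) = here refl
∈-perms (x ∷ y ∷ xs) = ∈-concatMap⁺′ (insertions x) (∈-perms (y ∷ xs)) (here refl)

insertions-map : ∀ (f : A → B) x ys →
                 insertions (f x) (map f ys) ≡ map (map f) (insertions x ys)
insertions-map f x [] = refl
insertions-map f x (y ∷ ys) = cong ((f x ∷ f y ∷ map f ys) ∷_) (begin
  map (f y ∷_) (insertions (f x) (map f ys))    ≡⟨ cong (map (f y ∷_)) (insertions-map f x ys) ⟩
  map (f y ∷_) (map (map f) (insertions x ys))  ≡⟨ map-∘ (insertions x ys) ⟨
  map (map f ∘ (y ∷_)) (insertions x ys)        ≡⟨ map-∘ (insertions x ys) ⟩
  map (map f) (map (y ∷_) (insertions x ys))    ∎)
  where open ≡-Reasoning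

perms-map : ∀ (f : A → B) xs → perms (map f xs) ≡ map (map f) (perms xs)
perms-map f [] = refl
perms-map f (x ∷ xs) = begin
  concatMap (insertions (f x)) (perms (map f xs))          ≡⟨ cong (concatMap _) (perms-map f xs) ⟩
  concatMap (insertions (f x)) (map (map f) (perms xs))    ≡⟨ concatMap-map _ (map f) (perms xs) ⟩
  concatMap (insertions (f x) ∘ map f) (perms xs)          ≡⟨ concatMap-cong (insertions-map f x) (perms xs) ⟩
  concatMap (map (map f) ∘ insertions x) (perms xs)        ≡⟨ map-concatMap (map f) (insertions x) (perms xs) ⟨
  map (map f) (concatMap (insertions x) (perms xs))        ∎
  where open ≡-Reasoning

length-insertions : ∀ (x : A) ys → length (insertions x ys) ≡ suc (length ys)
length-insertions x [] = refl
length-insertions x (y ∷ ys) =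
  cong suc (≡-trans (length-map (y ∷_) (insertions x ys)) (length-insertions x ys))

length-perms≤ : ∀ (xs : List A) → length (perms xs) ≤ length xs !
length-perms≤ [] = ≤-refl
length-perms≤ (x ∷ xs) = begin
  length (concatMap (insertions x) (perms xs)) ≤⟨ length-concatMap-≤ (insertions x) (perms xs) (suc (length xs))
                                                   (λ ys ys∈ → ≤-reflexive (length-insertions-perm ys ys∈)) ⟩
  length (perms xs) * suc (length xs)          ≤⟨ *-monoˡ-≤ (suc (length xs)) (length-perms≤ xs) ⟩
  length xs ! * suc (length xs)                ≡⟨ *-comm (length xs !) (suc (length xs)) ⟩
  suc (length xs) !                            ∎
  where
  open ≤-Reasoning
  length-insertions-perm : ∀ ys → ys ∈ perms xs → length (insertions x ys) ≡ suc (length xs)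
  length-insertions-perm ys ys∈ = ≡-trans (length-insertions x ys) (cong suc (↭-length (perms-↭ xs ys∈)))

stepwise⇒monotone : (f : ℕ → ℕ) → (∀ n → f n ≤ f (suc n)) → ∀ {m n} → m ≤ n → f m ≤ f n
stepwise⇒monotone f f-step {n = zero} z≤n = ≤-refl
stepwise⇒monotone f f-step {m} {suc n} m≤1+n with m≤n⇒m<n∨m≡n m≤1+n
... | inj₁ (s≤s m≤n) = ≤-trans (stepwise⇒monotone f f-step m≤n) (f-step n)
... | inj₂ refl = ≤-refl

!-mono-≤ : ∀ {m n} → m ≤ n → m ! ≤ n !
!-mono-≤ = stepwise⇒monotone _! (λ n → m≤m+n (n !) (n * n !))

!*!≤!+ : ∀ m n → m ! * n ! ≤ (m + n) !
!*!≤!+ zero n = ≤-reflexive (+-identityʳ (n !))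
!*!≤!+ (suc m) n = begin
  suc m * m ! * n !          ≡⟨ *-assoc (suc m) (m !) (n !) ⟩
  suc m * (m ! * n !)        ≤⟨ *-monoʳ-≤ (suc m) (!*!≤!+ m n) ⟩
  suc m * (m + n) !          ≤⟨ *-monoˡ-≤ ((m + n) !) (s≤s (m≤m+n m n)) ⟩
  suc (m + n) * (m + n) !    ∎
  where open ≤-Reasoning

size  : Res → ℕ
sizes : List Res → ℕ
size (var i) = 1
size (lam s) = suc (size s)
size (app s bs) = suc (size s + sizes bs)
sizes [] = 0
sizes (b ∷ bs) = size b + sizes bs

sizes≡sum : ∀ bs → sizes bs ≡ sum (map size bs)
sizes≡sum [] = refl
sizes≡sum (b ∷ bs) = cong (size b +_) (sizes≡sum bs)

sizes-↭ : ∀ {bs cs} → bs ↭ cs → sizes bs ≡ sizes cs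
sizes-↭ {bs} {cs} bs↭cs = begin
  sizes bs            ≡⟨ sizes≡sum bs ⟩
  sum (map size bs)   ≡⟨ sum-↭ (map⁺ size bs↭cs) ⟩
  sum (map size cs)   ≡⟨ sizes≡sum cs ⟨
  sizes cs            ∎
  where open ≡-Reasoning

length≤sizes : ∀ bs → length bs ≤ sizes bs
length≤sizes [] = z≤n
length≤sizes (b ∷ bs) = +-mono-≤ (0<size b) (length≤sizes bs)
  where
  0<size : ∀ s → 1 ≤ size s
  0<size (var i) = s≤s z≤n
  0<size (lam s) = s≤s z≤n
  0<size (app s bs) = s≤s z≤n

size-wkR  : ∀ c s → size (wkR c s) ≡ size s
sizes-wkRs : ∀ c bs → sizes (wkRs c bs) ≡ sizes bs
size-wkR c (var i) with i <ᵇ c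
... | true = refl
... | false = refl
size-wkR c (lam s) = cong suc (size-wkR (suc c) s)
size-wkR c (app s bs) = cong suc (cong₂ _+_ (size-wkR c s) (sizes-wkRs c bs))
sizes-wkRs c [] = refl
sizes-wkRs c (b ∷ bs) = cong₂ _+_ (size-wkR c b) (sizes-wkRs c bs)

size-wkRn : ∀ k s → size (wkRn k s) ≡ size s
size-wkRn zero s = refl
size-wkRn (suc k) s = ≡-trans (size-wkR 0 (wkRn k s)) (size-wkRn k s)

private
  +-≤-splice : ∀ a c e g {b d f} → a + b ≤ c + d → e + f ≤ g + b → (a + e) + f ≤ (c + g) + d
  +-≤-splice a c e g {b} {d} {f} ab≤cd ef≤gb = begin
    (a + e) + f    ≡⟨ +-assoc a e f ⟩
    a + (e + f)    ≤⟨ +-monoʳ-≤ a ef≤gb ⟩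
    a + (g + b)    ≡⟨ x∙yz≈y∙xz a g b ⟩
    g + (a + b)    ≤⟨ +-monoʳ-≤ g ab≤cd ⟩
    g + (c + d)    ≡⟨ x∙yz≈y∙xz g c d ⟩
    c + (g + d)    ≡⟨ +-assoc c g d ⟨
    (c + g) + d    ∎
    where open ≤-Reasoning

size-lsub  : ∀ k s ss → size (proj₁ (lsub k s ss)) + sizes (proj₂ (lsub k s ss)) ≤ size s + sizes ss
sizes-lsubs : ∀ k bs ss → sizes (proj₁ (lsubs k bs ss)) + sizes (proj₂ (lsubs k bs ss)) ≤ sizes bs + sizes ss
size-lsub k (var i) ss with i ≡ᵇ k
size-lsub k (var i) [] | true = ≤-refl
size-lsub k (var i) (s ∷ ss) | true rewrite size-wkRn k s = n≤1+n _
... | false with i <ᵇ k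
...   | true = ≤-refl
...   | false = ≤-refl
size-lsub k (lam s) ss with lsub (suc k) s ss | size-lsub (suc k) s ss
... | _ | s≤ = s≤s s≤
size-lsub k (app s bs) ss with lsub k s ss | size-lsub k s ss
... | s' , ss' | s≤ with lsubs k bs ss' | sizes-lsubs k bs ss'
...   | bs' , _ | bs≤ = s≤s (+-≤-splice (size s') (size s) (sizes bs') (sizes bs) s≤ bs≤)
sizes-lsubs k [] ss = ≤-refl
sizes-lsubs k (b ∷ bs) ss with lsub k b ss | size-lsub k b ss
... | b' , ss' | b≤ with lsubs k bs ss' | sizes-lsubs k bs ss'
...   | bs' , _ | bs≤ = +-≤-splice (size b') (size b) (sizes bs') (sizes bs) b≤ bs≤

-- t ≥r s with s a literal member of the reduct, not merely one up to ≈.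
infix 4 _≥ᵉ_
_≥ᵉ_ : Res → Res → Set
t ≥ᵉ s = Σ Sum λ a → Star _→r_ [ t ] a × s ∈ a

≥ᵉ-refl : ∀ t → t ≥ᵉ t
≥ᵉ-refl t = [ t ] , ε , here refl

→r-resp-↭ : ∀ {a a' b} → a ↭ a' → a →r b → a' →r b
→r-resp-↭ a↭a' (step α p r) = step α (↭-trans (↭-sym a↭a') p) r

→r*-resp-↭ : ∀ {a a' b} → a ↭ a' → Star _→r_ a b → Σ Sum λ b' → Star _→r_ a' b' × b' ↭ b
→r*-resp-↭ a↭a' ε = _ , ε , ↭-sym a↭a'
→r*-resp-↭ a↭a' (r ◅ rs) = _ , →r-resp-↭ a↭a' r ◅ rs , ↭-refl

private
  frame-↭ : ∀ (x p b q : Sum) → x ++ (p ++ b ++ q) ↭ p ++ (x ++ b) ++ q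
  frame-↭ x p b q = ↭-trans (shifts x p) (++⁺ˡ p (↭-reflexive (sym (++-assoc x b q))))

→r-frame : ∀ p q {a b} → a →r b → Σ Sum λ b' → p ++ a ++ q →r b' × b' ↭ p ++ b ++ q
→r-frame p q (step {a} {b} {t} {c} α a↭ r) =
  _ , step α (↭-trans (++⁺ˡ p (++⁺ʳ q a↭)) (↭-sym (frame-↭ (replicate (suc α) t) p b q))) r ,
  frame-↭ (concat (replicate (suc α) c)) p b q

→r*-frame : ∀ p q {a b} → Star _→r_ a b → Σ Sum λ b' → Star _→r_ (p ++ a ++ q) b' × b' ↭ p ++ b ++ q
→r*-frame p q ε = _ , ε , ↭-refl
→r*-frame p q (r ◅ rs) with →r-frame p q r
... | _ , r' , ↭₁ with →r*-frame p q rs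
...   | _ , rs' , ↭₂ with →r*-resp-↭ (↭-sym ↭₁) rs'
...     | b , rs'' , ↭₃ = b , r' ◅ rs'' , ↭-trans ↭₃ ↭₂

≥ᵉ-trans : ∀ {t u v} → t ≥ᵉ u → u ≥ᵉ v → t ≥ᵉ v
≥ᵉ-trans (a , rs , u∈a) (b , rs' , v∈b) with ∈-∃++ u∈a
... | p , q , refl with →r*-frame p q rs'
...   | b' , rs'' , b'↭ = b' , rs ◅◅ rs'' , ∈-resp-↭ (↭-sym b'↭) (∈-++⁺ʳ p (∈-++⁺ˡ v∈b))

Up-upward : ∀ {a t u} → t ≥ᵉ u → Up a u → Up a t
Up-upward t≥u (s , s∈a , b , rs , s' , s'∈b , s'≈s) with ≥ᵉ-trans t≥u (b , rs , s'∈b)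
... | c , rs' , s'∈c = s , s∈a , c , rs' , s' , s'∈c , s'≈s

≈-refl  : ∀ s → s ≈ s
≈ᵇ-refl : ∀ bs → bs ≈ᵇ bs
≈-refl (var i) = var
≈-refl (lam s) = lam (≈-refl s)
≈-refl (app s bs) = app (≈-refl s) (≈ᵇ-refl bs)
≈ᵇ-refl [] = []
≈ᵇ-refl (b ∷ bs) = ≈-refl b ∷ ≈ᵇ-refl bs

Up-inflationary : ∀ {a : Res → Set} {s} → a s → Up a s
Up-inflationary {s = s} s∈a = s , s∈a , [ s ] , ε , s , here refl , ≈-refl s

Context : (Res → Res) → Set
Context C = ∀ {t a} → t →₁ a → C t →₁ map C a

module _ {C : Res → Res} (C-context : Context C) where

  →r-context : ∀ {a b} → a →r b → map C a →r map C b
  →r-context (step {a} {b} {t} {c} α a↭ r) =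
    subst (map C a →r_) (sym map-reduct) (step α (subst (map C a ↭_) map-redex (map⁺ C a↭)) (C-context r))
    where
    map-redex : map C (replicate (suc α) t ++ b) ≡ replicate (suc α) (C t) ++ map C b
    map-redex = ≡-trans (map-++ C (replicate (suc α) t) b) (cong (_++ map C b) (map-replicate C (suc α) t))
    map-reduct : map C (concat (replicate (suc α) c) ++ b) ≡ concat (replicate (suc α) (map C c)) ++ map C b
    map-reduct = begin
      map C (concat (replicate (suc α) c) ++ b)         ≡⟨ map-++ C (concat (replicate (suc α) c)) b ⟩
      map C (concat (replicate (suc α) c)) ++ map C b   ≡⟨ cong (_++ map C b) (concat-map (replicate (suc α) c)) ⟨
      concat (map (map C) (replicate (suc α) c)) ++ map C b
                                                        ≡⟨ cong (λ z → concat z ++ map C b) (map-replicate (map C) (suc α) c) ⟩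
      concat (replicate (suc α) (map C c)) ++ map C b   ∎
      where open ≡-Reasoning

  →r*-context : ∀ {a b} → Star _→r_ a b → Star _→r_ (map C a) (map C b)
  →r*-context ε = ε
  →r*-context (r ◅ rs) = →r-context r ◅ →r*-context rs

  ≥ᵉ-context : ∀ {t s} → t ≥ᵉ s → C t ≥ᵉ C s
  ≥ᵉ-context (a , rs , s∈a) = map C a , →r*-context rs , ∈-map⁺ C s∈a

≥ᵉ-bag : ∀ t {bs cs} → Pointwise _≥ᵉ_ bs cs → app t bs ≥ᵉ app t cs
≥ᵉ-bag t = go []
  where
  go : ∀ done {bs cs} → Pointwise _≥ᵉ_ bs cs → app t (done ++ bs) ≥ᵉ app t (done ++ cs)
  go done [] = ≥ᵉ-refl _
  go done {b ∷ bs} {c ∷ cs} (b≥c ∷ bs≥cs) =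
    ≥ᵉ-trans (≥ᵉ-context (bagr {t} {bs = done} {cs = bs}) b≥c)
      (subst₂ (λ x y → app t x ≥ᵉ app t y) (++-assoc done [ c ] bs) (++-assoc done [ c ] cs)
        (go (done ++ [ c ]) bs≥cs))

𝒯Elem : Tm → Set
𝒯Elem M = Σ Res (𝒯 M)

𝒯Bag : Tm → Set
𝒯Bag M = Σ (List Res) (All (𝒯 M))

elemSize : ∀ {M} → 𝒯Elem M → ℕ
elemSize = size ∘ proj₁

𝒯-≃  : ∀ {M N} → M ≃ N → ∀ {s} → 𝒯 M s → 𝒯 N s
𝒯-≃⁻ : ∀ {M N} → M ≃ N → ∀ {s} → 𝒯 N s → 𝒯 M s
𝒯-≃ ≃-refl p = p
𝒯-≃ (≃-sym e) p = 𝒯-≃⁻ e p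
𝒯-≃ (≃-trans e e') p = 𝒯-≃ e' (𝒯-≃ e p)
𝒯-≃ (≃-lam e) (lam p) = lam (𝒯-≃ e p)
𝒯-≃ (≃-app e e') (app p ps) = app (𝒯-≃ e p) (All.map (𝒯-≃ e') ps)
𝒯-≃ (≃-sum e e') (sumL p) = sumL (𝒯-≃ e p)
𝒯-≃ (≃-sum e e') (sumR p) = sumR (𝒯-≃ e' p)
𝒯-≃ comm (sumL p) = sumR p
𝒯-≃ comm (sumR p) = sumL p
𝒯-≃ assoc (sumL (sumL p)) = sumL p
𝒯-≃ assoc (sumL (sumR p)) = sumR (sumL p)
𝒯-≃ assoc (sumR p) = sumR (sumR p)
𝒯-≃ lam-sum (lam (sumL p)) = sumL (lam p)
𝒯-≃ lam-sum (lam (sumR p)) = sumR (lam p)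
𝒯-≃ app-sum (app (sumL p) ps) = sumL (app p ps)
𝒯-≃ app-sum (app (sumR p) ps) = sumR (app p ps)
𝒯-≃⁻ ≃-refl p = p
𝒯-≃⁻ (≃-sym e) p = 𝒯-≃ e p
𝒯-≃⁻ (≃-trans e e') p = 𝒯-≃⁻ e (𝒯-≃⁻ e' p)
𝒯-≃⁻ (≃-lam e) (lam p) = lam (𝒯-≃⁻ e p)
𝒯-≃⁻ (≃-app e e') (app p ps) = app (𝒯-≃⁻ e p) (All.map (𝒯-≃⁻ e') ps)
𝒯-≃⁻ (≃-sum e e') (sumL p) = sumL (𝒯-≃⁻ e p)
𝒯-≃⁻ (≃-sum e e') (sumR p) = sumR (𝒯-≃⁻ e' p)
𝒯-≃⁻ comm (sumL p) = sumR p
𝒯-≃⁻ comm (sumR p) = sumL p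
𝒯-≃⁻ assoc (sumL p) = sumL (sumL p)
𝒯-≃⁻ assoc (sumR (sumL p)) = sumL (sumR p)
𝒯-≃⁻ assoc (sumR (sumR p)) = sumR p
𝒯-≃⁻ lam-sum (sumL (lam p)) = lam (sumL p)
𝒯-≃⁻ lam-sum (sumR (lam p)) = lam (sumR p)
𝒯-≃⁻ app-sum (sumL (app p ps)) = app (sumL p) ps
𝒯-≃⁻ app-sum (sumR (app p ps)) = app (sumR p) ps

private
  All-map-inverse : ∀ {P Q : Res → Set} {f : ∀ {s} → P s → Q s} {g : ∀ {s} → Q s → P s} →
                    (∀ {s} (q : Q s) → f (g q) ≡ q) → ∀ {bs} (qs : All Q bs) → All.map f (All.map g qs) ≡ qs
  All-map-inverse f∘g≗id qs = ≡-trans (All.map-∘ qs) (≡-trans (All.map-cong qs f∘g≗id) (All.map-id qs))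

𝒯-≃-inverseʳ : ∀ {M N} (e : M ≃ N) {s} (q : 𝒯 N s) → 𝒯-≃ e (𝒯-≃⁻ e q) ≡ q
𝒯-≃-inverseˡ : ∀ {M N} (e : M ≃ N) {s} (p : 𝒯 M s) → 𝒯-≃⁻ e (𝒯-≃ e p) ≡ p
𝒯-≃-inverseʳ ≃-refl q = refl
𝒯-≃-inverseʳ (≃-sym e) q = 𝒯-≃-inverseˡ e q
𝒯-≃-inverseʳ (≃-trans e e') q =
  ≡-trans (cong (𝒯-≃ e') (𝒯-≃-inverseʳ e (𝒯-≃⁻ e' q))) (𝒯-≃-inverseʳ e' q)
𝒯-≃-inverseʳ (≃-lam e) (lam q) = cong lam (𝒯-≃-inverseʳ e q)
𝒯-≃-inverseʳ (≃-app e e') (app q qs) = cong₂ app (𝒯-≃-inverseʳ e q) (All-map-inverse (𝒯-≃-inverseʳ e') qs)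
𝒯-≃-inverseʳ (≃-sum e e') (sumL q) = cong sumL (𝒯-≃-inverseʳ e q)
𝒯-≃-inverseʳ (≃-sum e e') (sumR q) = cong sumR (𝒯-≃-inverseʳ e' q)
𝒯-≃-inverseʳ comm (sumL q) = refl
𝒯-≃-inverseʳ comm (sumR q) = refl
𝒯-≃-inverseʳ assoc (sumL q) = refl
𝒯-≃-inverseʳ assoc (sumR (sumL q)) = refl
𝒯-≃-inverseʳ assoc (sumR (sumR q)) = refl
𝒯-≃-inverseʳ lam-sum (sumL (lam q)) = refl
𝒯-≃-inverseʳ lam-sum (sumR (lam q)) = refl
𝒯-≃-inverseʳ app-sum (sumL (app q qs)) = refl
𝒯-≃-inverseʳ app-sum (sumR (app q qs)) = refl
𝒯-≃-inverseˡ ≃-refl p = refl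
𝒯-≃-inverseˡ (≃-sym e) p = 𝒯-≃-inverseʳ e p
𝒯-≃-inverseˡ (≃-trans e e') p =
  ≡-trans (cong (𝒯-≃⁻ e) (𝒯-≃-inverseˡ e' (𝒯-≃ e p))) (𝒯-≃-inverseˡ e p)
𝒯-≃-inverseˡ (≃-lam e) (lam p) = cong lam (𝒯-≃-inverseˡ e p)
𝒯-≃-inverseˡ (≃-app e e') (app p ps) = cong₂ app (𝒯-≃-inverseˡ e p) (All-map-inverse (𝒯-≃-inverseˡ e') ps)
𝒯-≃-inverseˡ (≃-sum e e') (sumL p) = cong sumL (𝒯-≃-inverseˡ e p)
𝒯-≃-inverseˡ (≃-sum e e') (sumR p) = cong sumR (𝒯-≃-inverseˡ e' p)
𝒯-≃-inverseˡ comm (sumL p) = refl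
𝒯-≃-inverseˡ comm (sumR p) = refl
𝒯-≃-inverseˡ assoc (sumL (sumL p)) = refl
𝒯-≃-inverseˡ assoc (sumL (sumR p)) = refl
𝒯-≃-inverseˡ assoc (sumR p) = refl
𝒯-≃-inverseˡ lam-sum (lam (sumL p)) = refl
𝒯-≃-inverseˡ lam-sum (lam (sumR p)) = refl
𝒯-≃-inverseˡ app-sum (app (sumL p) ps) = refl
𝒯-≃-inverseˡ app-sum (app (sumR p) ps) = refl

𝒯-linear : ∀ M → Σ Res λ s → 𝒯 M s × Linear s
𝒯-linear (var i) = var i , var , var
𝒯-linear (lam M) with 𝒯-linear M
... | s , p , l = lam s , lam p , lam l
𝒯-linear (app M N) with 𝒯-linear M | 𝒯-linear N
... | s , p , l | t , q , k = app s [ t ] , app p (q ∷ []) , app l k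
𝒯-linear (M ⊕ N) with 𝒯-linear M
... | s , p , l = s , sumL p , l

derivations  : ∀ M s → List (𝒯 M s)
derivationsᵇ : ∀ N bs → List (All (𝒯 N) bs)
derivations (M ⊕ N) s = map sumL (derivations M s) ++ map sumR (derivations N s)
derivations (var i) (var j) with i ≟ j
... | yes refl = [ var ]
... | no _ = []
derivations (lam M) (lam s) = map lam (derivations M s)
derivations (app M N) (app s bs) = concatMap (λ p → map (app p) (derivationsᵇ N bs)) (derivations M s)
derivations _ _ = []
derivationsᵇ N [] = [ [] ]
derivationsᵇ N (b ∷ bs) = concatMap (λ p → map (p ∷_) (derivationsᵇ N bs)) (derivations N b)

∈-derivations  : ∀ {M s} (p : 𝒯 M s) → p ∈ derivations M s
∈-derivationsᵇ : ∀ {N bs} (ps : All (𝒯 N) bs) → ps ∈ derivationsᵇ N bs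
∈-derivations {var i} var with i ≟ i
... | yes refl = here refl
... | no i≢i = ⊥-elim (i≢i refl)
∈-derivations (lam p) = ∈-map⁺ lam (∈-derivations p)
∈-derivations (app p ps) = ∈-concatMap⁺′ _ (∈-derivations p) (∈-map⁺ (app p) (∈-derivationsᵇ ps))
∈-derivations (sumL p) = ∈-++⁺ˡ (∈-map⁺ sumL (∈-derivations p))
∈-derivations {M ⊕ N} {s} (sumR p) = ∈-++⁺ʳ (map sumL (derivations M s)) (∈-map⁺ sumR (∈-derivations p))
∈-derivationsᵇ [] = here refl
∈-derivationsᵇ (p ∷ ps) = ∈-concatMap⁺′ _ (∈-derivations p) (∈-map⁺ (p ∷_) (∈-derivationsᵇ ps))

𝒯-wk  : ∀ c {N s} → 𝒯 N s → 𝒯 (wkT c N) (wkR c s)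
𝒯-wkᵇ : ∀ c {N bs} → All (𝒯 N) bs → All (𝒯 (wkT c N)) (wkRs c bs)
𝒯-wk c {var i} var with i <ᵇ c
... | true = var
... | false = var
𝒯-wk c (lam p) = lam (𝒯-wk (suc c) p)
𝒯-wk c (app p ps) = app (𝒯-wk c p) (𝒯-wkᵇ c ps)
𝒯-wk c (sumL p) = sumL (𝒯-wk c p)
𝒯-wk c (sumR p) = sumR (𝒯-wk c p)
𝒯-wkᵇ c [] = []
𝒯-wkᵇ c (p ∷ ps) = 𝒯-wk c p ∷ 𝒯-wkᵇ c ps

wk-elem : ∀ c {N} → 𝒯Elem N → 𝒯Elem (wkT c N)
wk-elem c (s , p) = wkR c s , 𝒯-wk c p

wk-bag : ∀ c {N} → 𝒯Bag N → 𝒯Bag (wkT c N)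
wk-bag c (bs , ps) = wkRs c bs , 𝒯-wkᵇ c ps

wk-elem-surjective : ∀ c N (q : 𝒯Elem (wkT c N)) → Σ (𝒯Elem N) λ p → wk-elem c p ≡ q
wk-bag-surjective  : ∀ c N (qs : 𝒯Bag (wkT c N)) → Σ (𝒯Bag N) λ ps → wk-bag c ps ≡ qs
wk-elem-surjective c (var i) q = (var i , var) , wk-var i q
  where
  wk-var : ∀ i (q : 𝒯Elem (wkT c (var i))) → wk-elem c (var i , var) ≡ q
  wk-var i q with i <ᵇ c
  wk-var i (_ , var) | true = refl
  wk-var i (_ , var) | false = refl
wk-elem-surjective c (lam N) (lam s , lam q) with wk-elem-surjective (suc c) N (s , q)
... | (s' , p) , refl = (lam s' , lam p) , refl
wk-elem-surjective c (app M N) (app s bs , app q qs) with wk-elem-surjective c M (s , q) | wk-bag-surjective c N (bs , qs)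
... | (s' , p) , refl | (bs' , ps) , refl = (app s' bs' , app p ps) , refl
wk-elem-surjective c (M ⊕ N) (s , sumL q) with wk-elem-surjective c M (s , q)
... | (s' , p) , refl = (s' , sumL p) , refl
wk-elem-surjective c (M ⊕ N) (s , sumR q) with wk-elem-surjective c N (s , q)
... | (s' , p) , refl = (s' , sumR p) , refl
wk-bag-surjective c N ([] , []) = ([] , []) , refl
wk-bag-surjective c N (b ∷ bs , q ∷ qs) with wk-elem-surjective c N (b , q) | wk-bag-surjective c N (bs , qs)
... | (b' , p) , refl | (bs' , ps) , refl = (b' ∷ bs' , p ∷ ps) , refl

𝒯-wkn : ∀ k {N s} → 𝒯 N s → 𝒯 (wkTn k N) (wkRn k s)
𝒯-wkn zero p = p
𝒯-wkn (suc k) p = 𝒯-wk 0 (𝒯-wkn k p)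

wkn-elem : ∀ k {N} → 𝒯Elem N → 𝒯Elem (wkTn k N)
wkn-elem k (s , p) = wkRn k s , 𝒯-wkn k p

wkn-elem-surjective : ∀ k N (q : 𝒯Elem (wkTn k N)) → Σ (𝒯Elem N) λ p → wkn-elem k p ≡ q
wkn-elem-surjective zero N q = q , refl
wkn-elem-surjective (suc k) N q with wk-elem-surjective 0 (wkTn k N) q
... | q' , refl with wkn-elem-surjective k N q'
...   | p , refl = p , refl

module _ {N : Tm} where

  -- Mirrors lsub, except that it fails when the list runs out.
  𝒯-lsub  : ∀ k {A a} → 𝒯 A a → List (𝒯Elem N) → Maybe (𝒯Elem (substT k N A) × List (𝒯Elem N))
  𝒯-lsubᵇ : ∀ k {B bs} → All (𝒯 B) bs → List (𝒯Elem N) → Maybe (𝒯Bag (substT k N B) × List (𝒯Elem N))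
  𝒯-lsub k {var i} var xs with i ≡ᵇ k
  𝒯-lsub k {var i} var [] | true = nothing
  𝒯-lsub k {var i} var (x ∷ xs) | true = just (wkn-elem k x , xs)
  ... | false with i <ᵇ k
  ...   | true = just ((var i , var) , xs)
  ...   | false = just ((var (pred i) , var) , xs)
  𝒯-lsub k (lam p) xs with 𝒯-lsub (suc k) p xs
  ... | nothing = nothing
  ... | just ((r , q) , ys) = just ((lam r , lam q) , ys)
  𝒯-lsub k (app p ps) xs with 𝒯-lsub k p xs
  ... | nothing = nothing
  ... | just ((r , q) , ys) with 𝒯-lsubᵇ k ps ys
  ...   | nothing = nothing
  ...   | just ((rs , qs) , zs) = just ((app r rs , app q qs) , zs)
  𝒯-lsub k (sumL p) xs with 𝒯-lsub k p xs
  ... | nothing = nothing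
  ... | just ((r , q) , ys) = just ((r , sumL q) , ys)
  𝒯-lsub k (sumR p) xs with 𝒯-lsub k p xs
  ... | nothing = nothing
  ... | just ((r , q) , ys) = just ((r , sumR q) , ys)
  𝒯-lsubᵇ k [] xs = just (([] , []) , xs)
  𝒯-lsubᵇ k (p ∷ ps) xs with 𝒯-lsub k p xs
  ... | nothing = nothing
  ... | just ((r , q) , ys) with 𝒯-lsubᵇ k ps ys
  ...   | nothing = nothing
  ...   | just ((rs , qs) , zs) = just ((r ∷ rs , q ∷ qs) , zs)

  𝒯-lsub-sound  : ∀ k {A a} (p : 𝒯 A a) xs {r ys} → 𝒯-lsub k p xs ≡ just (r , ys) →
                  lsub k a (map proj₁ xs) ≡ (proj₁ r , map proj₁ ys)
  𝒯-lsubᵇ-sound : ∀ k {B bs} (ps : All (𝒯 B) bs) xs {rs ys} → 𝒯-lsubᵇ k ps xs ≡ just (rs , ys) →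
                  lsubs k bs (map proj₁ xs) ≡ (proj₁ rs , map proj₁ ys)
  𝒯-lsub-sound k {var i} var xs eq with i ≡ᵇ k
  𝒯-lsub-sound k {var i} var [] () | true
  𝒯-lsub-sound k {var i} var (x ∷ xs) refl | true = refl
  ... | false with i <ᵇ k
  𝒯-lsub-sound k {var i} var xs refl | false | true = refl
  𝒯-lsub-sound k {var i} var xs refl | false | false = refl
  𝒯-lsub-sound k (lam p) xs eq with 𝒯-lsub (suc k) p xs in e
  𝒯-lsub-sound k (lam p) xs refl | just _ rewrite 𝒯-lsub-sound (suc k) p xs e = refl
  𝒯-lsub-sound k (app p ps) xs eq with 𝒯-lsub k p xs in e
  ... | just (_ , ys) with 𝒯-lsubᵇ k ps ys in e'
  𝒯-lsub-sound k (app p ps) xs refl | just (_ , ys) | just _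
    rewrite 𝒯-lsub-sound k p xs e | 𝒯-lsubᵇ-sound k ps ys e' = refl
  𝒯-lsub-sound k (sumL p) xs eq with 𝒯-lsub k p xs in e
  𝒯-lsub-sound k (sumL p) xs refl | just _ = 𝒯-lsub-sound k p xs e
  𝒯-lsub-sound k (sumR p) xs eq with 𝒯-lsub k p xs in e
  𝒯-lsub-sound k (sumR p) xs refl | just _ = 𝒯-lsub-sound k p xs e
  𝒯-lsubᵇ-sound k [] xs refl = refl
  𝒯-lsubᵇ-sound k (p ∷ ps) xs eq with 𝒯-lsub k p xs in e
  ... | just (_ , ys) with 𝒯-lsubᵇ k ps ys in e'
  𝒯-lsubᵇ-sound k (p ∷ ps) xs refl | just (_ , ys) | just _
    rewrite 𝒯-lsub-sound k p xs e | 𝒯-lsubᵇ-sound k ps ys e' = refl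

  𝒯-lsub-complete  : ∀ k A (q : 𝒯Elem (substT k N A)) →
                     Σ (𝒯Elem A) λ p → Σ (List (𝒯Elem N)) λ xs → length xs ≡ occ k (proj₁ p) ×
                       (∀ rest → 𝒯-lsub k (proj₂ p) (xs ++ rest) ≡ just (q , rest))
  𝒯-lsubᵇ-complete : ∀ k B (qs : 𝒯Bag (substT k N B)) →
                     Σ (𝒯Bag B) λ ps → Σ (List (𝒯Elem N)) λ xs → length xs ≡ occs k (proj₁ ps) ×
                       (∀ rest → 𝒯-lsubᵇ k (proj₂ ps) (xs ++ rest) ≡ just (qs , rest))
  𝒯-lsub-complete k (var i) q = (var i , var) , complete-var i q
    where
    complete-var : ∀ i (q : 𝒯Elem (substT k N (var i))) →
                   Σ (List (𝒯Elem N)) λ xs → length xs ≡ occ k (var i) ×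
                     (∀ rest → 𝒯-lsub k {var i} var (xs ++ rest) ≡ just (q , rest))
    complete-var i q with i ≡ᵇ k
    ... | true with wkn-elem-surjective k N q
    ...   | x , refl = [ x ] , refl , λ rest → refl
    complete-var i q | false with i <ᵇ k
    complete-var i (_ , var) | false | true = [] , refl , λ rest → refl
    complete-var i (_ , var) | false | false = [] , refl , λ rest → refl
  𝒯-lsub-complete k (lam A) (lam s , lam q) with 𝒯-lsub-complete (suc k) A (s , q)
  ... | (a , p) , xs , length≡ , sub = (lam a , lam p) , xs , length≡ , λ rest → sub-lam rest
    where
    sub-lam : ∀ rest → 𝒯-lsub k (lam p) (xs ++ rest) ≡ just ((lam s , lam q) , rest)
    sub-lam rest rewrite sub rest = refl
  𝒯-lsub-complete k (app A B) (app s cs , app q qs)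
    with 𝒯-lsub-complete k A (s , q) | 𝒯-lsubᵇ-complete k B (cs , qs)
  ... | (a , p) , xs , length≡ , sub | (bs , ps) , ys , length≡' , subᵇ =
    (app a bs , app p ps) , xs ++ ys , ≡-trans (length-++ xs) (cong₂ _+_ length≡ length≡') , sub-app
    where
    sub-app : ∀ rest → 𝒯-lsub k (app p ps) ((xs ++ ys) ++ rest) ≡ just ((app s cs , app q qs) , rest)
    sub-app rest rewrite ++-assoc xs ys rest | sub (ys ++ rest) | subᵇ rest = refl
  𝒯-lsub-complete k (A ⊕ B) (s , sumL q) with 𝒯-lsub-complete k A (s , q)
  ... | (a , p) , xs , length≡ , sub = (a , sumL p) , xs , length≡ , sub-sumL
    where
    sub-sumL : ∀ rest → 𝒯-lsub k (sumL {N = B} p) (xs ++ rest) ≡ just ((s , sumL q) , rest)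
    sub-sumL rest rewrite sub rest = refl
  𝒯-lsub-complete k (A ⊕ B) (s , sumR q) with 𝒯-lsub-complete k B (s , q)
  ... | (a , p) , xs , length≡ , sub = (a , sumR p) , xs , length≡ , sub-sumR
    where
    sub-sumR : ∀ rest → 𝒯-lsub k (sumR {M = A} p) (xs ++ rest) ≡ just ((s , sumR q) , rest)
    sub-sumR rest rewrite sub rest = refl
  𝒯-lsubᵇ-complete k B ([] , []) = ([] , []) , [] , refl , λ rest → refl
  𝒯-lsubᵇ-complete k B (c ∷ cs , q ∷ qs) with 𝒯-lsub-complete k B (c , q) | 𝒯-lsubᵇ-complete k B (cs , qs)
  ... | (a , p) , xs , length≡ , sub | (bs , ps) , ys , length≡' , subᵇ =
    (a ∷ bs , p ∷ ps) , xs ++ ys , ≡-trans (length-++ xs) (cong₂ _+_ length≡ length≡') , sub-cons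
    where
    sub-cons : ∀ rest → 𝒯-lsubᵇ k (p ∷ ps) ((xs ++ ys) ++ rest) ≡ just ((c ∷ cs , q ∷ qs) , rest)
    sub-cons rest rewrite ++-assoc xs ys rest | sub (ys ++ rest) | subᵇ rest = refl

-- Simulating a β-step on the Taylor support

toList-fromList : ∀ {N} (xs : List (𝒯Elem N)) → All.toList (All.fromList xs) ≡ xs
toList-fromList [] = refl
toList-fromList (x ∷ xs) = cong (x ∷_) (toList-fromList xs)

fromList-toList : ∀ {N bs} (ps : All (𝒯 N) bs) →
                  _≡_ {A = 𝒯Bag N} (map proj₁ (All.toList ps) , All.fromList (All.toList ps)) (bs , ps)
fromList-toList [] = refl
fromList-toList (p ∷ ps) = cong (λ (qs : 𝒯Bag _) → _ ∷ proj₁ qs , p ∷ proj₂ qs) (fromList-toList ps)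

map-proj₁-toList : ∀ {N bs} (ps : All (𝒯 N) bs) → map proj₁ (All.toList ps) ≡ bs
map-proj₁-toList ps = cong proj₁ (fromList-toList ps)

maybe-fst : Maybe (A × B) → List A
maybe-fst nothing = []
maybe-fst (just (x , _)) = [ x ]

𝒯-βres : ∀ {A N a bs} → 𝒯 A a → All (𝒯 N) bs → List (𝒯Elem (substT 0 N A))
𝒯-βres {a = a} {bs} p ps =
  if occ 0 a ≡ᵇ length bs then concatMap (maybe-fst ∘ 𝒯-lsub 0 p) (perms (All.toList ps)) else []

bag-elem : ∀ {M N} → 𝒯Elem M → List (𝒯Elem N) → 𝒯Elem (app M N)
bag-elem (s , p) ys = app s (map proj₁ ys) , app p (All.fromList ys)

𝒯-step : ∀ {M N} → M →β N → 𝒯Elem M → List (𝒯Elem N)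
𝒯-step beta (app (lam a) bs , app (lam p) ps) = 𝒯-βres p ps
𝒯-step (lamβ d) (lam s , lam p) = map (λ (r , q) → lam r , lam q) (𝒯-step d (s , p))
𝒯-step (appL d) (app s bs , app p ps) = map (λ (r , q) → app r bs , app q ps) (𝒯-step d (s , p))
𝒯-step (appR d) (app s bs , app p ps) = map (bag-elem (s , p)) (products (map (𝒯-step d) (All.toList ps)))
𝒯-step (sumL d) (s , sumL p) = map (λ (r , q) → r , sumL q) (𝒯-step d (s , p))
𝒯-step (sumL d) (s , sumR p) = [ s , sumR p ]
𝒯-step (sumR d) (s , sumL p) = [ s , sumL p ]
𝒯-step (sumR d) (s , sumR p) = map (λ (r , q) → r , sumR q) (𝒯-step d (s , p))

≡ᵇ-refl : ∀ n → (n ≡ᵇ n) ≡ true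
≡ᵇ-refl zero = refl
≡ᵇ-refl (suc n) = ≡ᵇ-refl n

𝒯-step-complete : ∀ {M N} (d : M →β N) (q : 𝒯Elem N) → Σ (𝒯Elem M) λ p → q ∈ 𝒯-step d p
𝒯-step-complete (beta {A} {N}) q with 𝒯-lsub-complete 0 A q
... | (a , p) , xs , length≡ , sub = (app (lam a) (map proj₁ xs) , app (lam p) (All.fromList xs)) , q∈
  where
  q∈ : q ∈ 𝒯-βres p (All.fromList xs)
  q∈ rewrite toList-fromList xs | length-map proj₁ xs | length≡ | ≡ᵇ-refl (occ 0 a) =
    ∈-concatMap⁺′ _ (∈-perms xs)
      (subst (λ xs' → q ∈ maybe-fst (𝒯-lsub 0 p xs')) (++-identityʳ xs)
        (subst (λ r → q ∈ maybe-fst r) (sym (sub [])) (here refl)))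
𝒯-step-complete (lamβ d) (lam s , lam q) with 𝒯-step-complete d (s , q)
... | (r , p) , q∈ = (lam r , lam p) , ∈-map⁺ _ q∈
𝒯-step-complete (appL d) (app s bs , app q qs) with 𝒯-step-complete d (s , q)
... | (r , p) , q∈ = (app r bs , app p qs) , ∈-map⁺ _ q∈
𝒯-step-complete (appR d) (app s cs , app q qs) =
  bag-elem (s , q) preimages , subst (_∈ 𝒯-step (appR d) (bag-elem (s , q) preimages)) bag≡ q∈
  where
  preimage = λ y → proj₁ (𝒯-step-complete d y)
  preimages = map preimage (All.toList qs)
  reducts : ∀ ys → Pointwise _∈_ ys (map (𝒯-step d) (map preimage ys))
  reducts [] = []
  reducts (y ∷ ys) = proj₂ (𝒯-step-complete d y) ∷ reducts ys
  bag≡ : bag-elem (s , q) (All.toList qs) ≡ (app s cs , app q qs)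
  bag≡ = cong (λ (rs : 𝒯Bag _) → app s (proj₁ rs) , app q (proj₂ rs)) (fromList-toList qs)
  q∈ : bag-elem (s , q) (All.toList qs) ∈ 𝒯-step (appR d) (bag-elem (s , q) preimages)
  q∈ rewrite toList-fromList preimages = ∈-map⁺ _ (∈-products⁺ (reducts (All.toList qs)))
𝒯-step-complete (sumL d) (s , sumL q) with 𝒯-step-complete d (s , q)
... | (r , p) , q∈ = (r , sumL p) , ∈-map⁺ _ q∈
𝒯-step-complete (sumL d) (s , sumR q) = (s , sumR q) , here refl
𝒯-step-complete (sumR d) (s , sumL q) = (s , sumL q) , here refl
𝒯-step-complete (sumR d) (s , sumR q) with 𝒯-step-complete d (s , q)
... | (r , p) , q∈ = (r , sumR p) , ∈-map⁺ _ q∈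

𝒯-βres-sound : ∀ {A N a bs} (p : 𝒯 A a) (ps : All (𝒯 N) bs) {r} → r ∈ 𝒯-βres p ps →
               app (lam a) bs ≥ᵉ proj₁ r
𝒯-βres-sound {a = a} {bs} p ps r∈ with occ 0 a ≡ᵇ length bs in occ≡
... | true with ∈-concatMap⁻′ _ (perms (All.toList ps)) r∈
...   | xs , xs∈ , r∈′ with 𝒯-lsub 0 p xs in sub
...     | just (r , _) with r∈′
...       | here refl = (βres a bs ++ []) ++ [] , step 0 ↭-refl βr ◅ ε , ∈-++⁺ˡ (∈-++⁺ˡ r∈βres)
  where
  bs∈perms : map proj₁ xs ∈ perms bs
  bs∈perms = subst (map proj₁ xs ∈_)
               (≡-trans (sym (perms-map proj₁ (All.toList ps))) (cong perms (map-proj₁-toList ps)))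
               (∈-map⁺ (map proj₁) xs∈)
  r∈βres : proj₁ r ∈ βres a bs
  r∈βres rewrite occ≡ = subst (_∈ map (λ ss → proj₁ (lsub 0 a ss)) (perms bs))
                          (cong proj₁ (𝒯-lsub-sound 0 p xs sub)) (∈-map⁺ _ bs∈perms)

𝒯-step-sound : ∀ {M N} (d : M →β N) p {q} → q ∈ 𝒯-step d p → proj₁ p ≥ᵉ proj₁ q
𝒯-step-sound beta (app (lam a) bs , app (lam p) ps) q∈ = 𝒯-βres-sound p ps q∈
𝒯-step-sound (lamβ d) (lam s , lam p) q∈ with ∈-map⁻ _ q∈
... | _ , r∈ , refl = ≥ᵉ-context lamr (𝒯-step-sound d (s , p) r∈)
𝒯-step-sound (appL d) (app s bs , app p ps) q∈ with ∈-map⁻ _ q∈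
... | _ , r∈ , refl = ≥ᵉ-context {λ u → app u bs} appL (𝒯-step-sound d (s , p) r∈)
𝒯-step-sound (appR d) (app s bs , app p ps) q∈ with ∈-map⁻ _ q∈
... | ys , ys∈ , refl = ≥ᵉ-bag s (pointwise-sound ps (∈-products⁻ (map (𝒯-step d) (All.toList ps)) ys∈))
  where
  pointwise-sound : ∀ {bs} (ps : All (𝒯 _) bs) {ys} →
                    Pointwise _∈_ ys (map (𝒯-step d) (All.toList ps)) → Pointwise _≥ᵉ_ bs (map proj₁ ys)
  pointwise-sound [] [] = []
  pointwise-sound (p ∷ ps) (y∈ ∷ ys∈) = 𝒯-step-sound d (_ , p) y∈ ∷ pointwise-sound ps ys∈
𝒯-step-sound (sumL d) (s , sumL p) q∈ with ∈-map⁻ _ q∈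
... | _ , r∈ , refl = 𝒯-step-sound d (s , p) r∈
𝒯-step-sound (sumL d) (s , sumR p) (here refl) = ≥ᵉ-refl s
𝒯-step-sound (sumR d) (s , sumL p) (here refl) = ≥ᵉ-refl s
𝒯-step-sound (sumR d) (s , sumR p) q∈ with ∈-map⁻ _ q∈
... | _ , r∈ , refl = 𝒯-step-sound d (s , p) r∈

-- The reducts of an element are smaller, in a multiset sense

-- The factorial bounds the number of orderings of a bag, hence of the reducts of a redex.
StrictlyBelow : (A → ℕ) → ℕ → List A → Set
StrictlyBelow w n xs = (∀ x → x ∈ xs → w x < n) × length xs ≤ n !

data Below (w : A → ℕ) (n : ℕ) : List A → Set where
  single : ∀ {x} → w x ≤ n → Below w n [ x ]
  strict : ∀ {xs} → StrictlyBelow w n xs → Below w n xs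

Below⇒weight≤ : ∀ {w : A → ℕ} {n xs} → Below w n xs → ∀ x → x ∈ xs → w x ≤ n
Below⇒weight≤ (single wx≤n) x (here refl) = wx≤n
Below⇒weight≤ (strict (w< , _)) x x∈ = <⇒≤ (w< x x∈)

Below⇒length≤ : ∀ {w : A → ℕ} {n xs} → Below w n xs → length xs ≤ n !
Below⇒length≤ {n = n} (single _) = 1≤n! n
Below⇒length≤ (strict (_ , length≤)) = length≤

module _ {F : ℕ → ℕ} (F-mono : F Preserves _<_ ⟶ _<_) where

  strictlyMonotone⇒inflationary : ∀ n → n ≤ F n
  strictlyMonotone⇒inflationary zero = z≤n
  strictlyMonotone⇒inflationary (suc n) = ≤-<-trans (strictlyMonotone⇒inflationary n) (F-mono (n<1+n n))

  strictlyMonotone⇒monotone : ∀ {m n} → m ≤ n → F m ≤ F n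
  strictlyMonotone⇒monotone m≤n with m≤n⇒m<n∨m≡n m≤n
  ... | inj₁ m<n = <⇒≤ (F-mono m<n)
  ... | inj₂ refl = ≤-refl

  module _ {w : A → ℕ} {w' : B → ℕ} (f : A → B) (w'∘f≡F∘w : ∀ x → w' (f x) ≡ F (w x)) where

    StrictlyBelow-map : ∀ {n xs} → StrictlyBelow w n xs → StrictlyBelow w' (F n) (map f xs)
    StrictlyBelow-map {n} {xs} (w< , length≤) = w'< , length-map≤
      where
      w'< : ∀ y → y ∈ map f xs → w' y < F n
      w'< y y∈ with ∈-map⁻ f y∈
      ... | x , x∈ , refl = subst (_< F n) (sym (w'∘f≡F∘w x)) (F-mono (w< x x∈))
      length-map≤ : length (map f xs) ≤ F n !
      length-map≤ = ≤-trans (≤-reflexive (length-map f xs))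
                      (≤-trans length≤ (!-mono-≤ (strictlyMonotone⇒inflationary n)))

    Below-map : ∀ {n xs} → Below w n xs → Below w' (F n) (map f xs)
    Below-map (single {x} wx≤n) = single (subst (_≤ _) (sym (w'∘f≡F∘w x)) (strictlyMonotone⇒monotone wx≤n))
    Below-map (strict below) = strict (StrictlyBelow-map below)

𝒯-βres-strictlyBelow : ∀ {A N a bs} (p : 𝒯 A a) (ps : All (𝒯 N) bs) →
                       StrictlyBelow elemSize (size (app (lam a) bs)) (𝒯-βres p ps)
𝒯-βres-strictlyBelow {a = a} {bs} p ps with occ 0 a ≡ᵇ length bs
... | false = (λ _ ()) , z≤n
... | true = smaller , few
  where
  substitute = maybe-fst ∘ 𝒯-lsub 0 p
  orderings = perms (All.toList ps)
  smaller : ∀ r → r ∈ concatMap substitute orderings → elemSize r < size (app (lam a) bs)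
  smaller r r∈ with ∈-concatMap⁻′ substitute orderings r∈
  ... | xs , xs∈ , r∈′ with 𝒯-lsub 0 p xs in sub
  ...   | just (_ , ys) with r∈′
  ...     | here refl = s≤s (m≤n⇒m≤1+n (begin
    size (proj₁ r)                             ≤⟨ m≤m+n _ _ ⟩
    size (proj₁ r) + sizes (map proj₁ ys)      ≤⟨ subst (λ (r′ , ys′) → size r′ + sizes ys′ ≤ size a + sizes (map proj₁ xs))
                                                     (𝒯-lsub-sound 0 p xs sub) (size-lsub 0 a (map proj₁ xs)) ⟩
    size a + sizes (map proj₁ xs)              ≡⟨ cong (size a +_) sizes-xs ⟩
    size a + sizes bs                          ∎))
    where
    open ≤-Reasoning
    sizes-xs : sizes (map proj₁ xs) ≡ sizes bs
    sizes-xs = ≡-trans (sizes-↭ (map⁺ proj₁ (perms-↭ (All.toList ps) xs∈))) (cong sizes (map-proj₁-toList ps))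
  at-most-one : ∀ xs → length (substitute xs) ≤ 1
  at-most-one xs with 𝒯-lsub 0 p xs
  ... | nothing = z≤n
  ... | just _ = ≤-refl
  few : length (concatMap substitute orderings) ≤ size (app (lam a) bs) !
  few = begin
    length (concatMap substitute orderings) ≤⟨ length-concatMap-≤ substitute orderings 1 (λ xs _ → at-most-one xs) ⟩
    length orderings * 1                    ≡⟨ *-identityʳ _ ⟩
    length orderings                        ≤⟨ length-perms≤ (All.toList ps) ⟩
    length (All.toList ps) !                ≡⟨ cong _! (≡-trans (sym (length-map proj₁ (All.toList ps)))
                                                               (cong length (map-proj₁-toList ps))) ⟩
    length bs !                             ≤⟨ !-mono-≤ (≤-trans (length≤sizes bs) (m≤n+m (sizes bs) (suc (size a)))) ⟩
    (suc (size a) + sizes bs) !             ≤⟨ !-mono-≤ (n≤1+n (suc (size a) + sizes bs)) ⟩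
    size (app (lam a) bs) !                 ∎
    where open ≤-Reasoning

module _ {w : A → ℕ} where

  private
    weight : List A → ℕ
    weight = sum ∘ map w

  prepend-StrictlyBelow : ∀ {m n xs P} → Below w m xs → Below weight n P →
                          StrictlyBelow w m xs ⊎ StrictlyBelow weight n P →
                          StrictlyBelow weight (m + n) (concatMap (λ x → map (x ∷_) P) xs)
  prepend-StrictlyBelow {m} {n} {xs} {P} xs-below P-below one-strict = smaller , few
    where
    cons-smaller : StrictlyBelow w m xs ⊎ StrictlyBelow weight n P →
                   ∀ {x p} → x ∈ xs → p ∈ P → w x + weight p < m + n
    cons-smaller (inj₁ (w< , _)) x∈ p∈ = +-mono-<-≤ (w< _ x∈) (Below⇒weight≤ P-below _ p∈)
    cons-smaller (inj₂ (w< , _)) x∈ p∈ = +-mono-≤-< (Below⇒weight≤ xs-below _ x∈) (w< _ p∈)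
    smaller : ∀ y → y ∈ concatMap (λ x → map (x ∷_) P) xs → weight y < m + n
    smaller y y∈ with ∈-concatMap⁻′ _ xs y∈
    ... | x , x∈ , y∈′ with ∈-map⁻ (x ∷_) y∈′
    ...   | p , p∈ , refl = cons-smaller one-strict x∈ p∈
    few : length (concatMap (λ x → map (x ∷_) P) xs) ≤ (m + n) !
    few = begin
      length (concatMap (λ x → map (x ∷_) P) xs) ≤⟨ length-concatMap-≤ _ xs (length P) (λ x _ → ≤-reflexive (length-map (x ∷_) P)) ⟩
      length xs * length P                       ≤⟨ *-mono-≤ (Below⇒length≤ xs-below) (Below⇒length≤ P-below) ⟩
      m ! * n !                                  ≤⟨ !*!≤!+ m n ⟩
      (m + n) !                                  ∎
      where open ≤-Reasoning

  products-Below : ∀ {ns xss} → Pointwise (Below w) ns xss → Below weight (sum ns) (products xss)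
  products-Below [] = single ≤-refl
  products-Below {_ ∷ ns} {_ ∷ xss} (xs-below ∷ xss-below) with products xss | products-Below {ns} xss-below
  ... | _ | single p≤ with xs-below
  ...   | single x≤ = single (+-mono-≤ x≤ p≤)
  ...   | strict xs-strict = strict (prepend-StrictlyBelow xs-below (single p≤) (inj₁ xs-strict))
  products-Below (xs-below ∷ _) | _ | strict P-strict =
    strict (prepend-StrictlyBelow xs-below (strict P-strict) (inj₂ P-strict))

sizes-map-proj₁ : ∀ {N} (ys : List (𝒯Elem N)) → sizes (map proj₁ ys) ≡ sum (map elemSize ys)
sizes-map-proj₁ ys = ≡-trans (sizes≡sum (map proj₁ ys)) (cong sum (sym (map-∘ ys)))

private
  suc-+ˡ-strictlyMonotone : ∀ c → (λ n → suc (c + n)) Preserves _<_ ⟶ _<_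
  suc-+ˡ-strictlyMonotone c = s≤s ∘ +-monoʳ-< c

  suc-+ʳ-strictlyMonotone : ∀ c → (λ n → suc (n + c)) Preserves _<_ ⟶ _<_
  suc-+ʳ-strictlyMonotone c = s≤s ∘ +-monoˡ-< c

𝒯-step-Below : ∀ {M N} (d : M →β N) p → Below elemSize (elemSize p) (𝒯-step d p)
𝒯-step-Below beta (app (lam a) bs , app (lam p) ps) = strict (𝒯-βres-strictlyBelow p ps)
𝒯-step-Below (lamβ d) (lam s , lam p) = Below-map s≤s _ (λ _ → refl) (𝒯-step-Below d (s , p))
𝒯-step-Below (appL d) (app s bs , app p ps) =
  Below-map (suc-+ʳ-strictlyMonotone (sizes bs)) _ (λ _ → refl) (𝒯-step-Below d (s , p))
𝒯-step-Below (appR d) (app s bs , app p ps) =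
  subst (λ n → Below elemSize (suc (size s + n)) (𝒯-step (appR d) (app s bs , app p ps))) sum≡sizes
    (Below-map (suc-+ˡ-strictlyMonotone (size s)) (bag-elem (s , p))
      (λ ys → cong (λ n → suc (size s + n)) (sizes-map-proj₁ ys))
      (products-Below (pointwise (All.toList ps))))
  where
  pointwise : ∀ ys → Pointwise (Below elemSize) (map elemSize ys) (map (𝒯-step d) ys)
  pointwise [] = []
  pointwise (y ∷ ys) = 𝒯-step-Below d y ∷ pointwise ys
  sum≡sizes : sum (map elemSize (All.toList ps)) ≡ sizes bs
  sum≡sizes = ≡-trans (sym (sizes-map-proj₁ (All.toList ps))) (cong sizes (map-proj₁-toList ps))
𝒯-step-Below (sumL d) (s , sumL p) = Below-map id _ (λ _ → refl) (𝒯-step-Below d (s , p))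
𝒯-step-Below (sumL d) (s , sumR p) = single ≤-refl
𝒯-step-Below (sumR d) (s , sumL p) = single ≤-refl
𝒯-step-Below (sumR d) (s , sumR p) = Below-map id _ (λ _ → refl) (𝒯-step-Below d (s , p))

𝒯-step-strict : ∀ {M N} (d : M →β N) →
                Σ (𝒯Elem M) λ p → Linear (proj₁ p) × StrictlyBelow elemSize (elemSize p) (𝒯-step d p)
𝒯-step-strict (beta {A} {N}) with 𝒯-linear A | 𝒯-linear N
... | a , p , a-lin | t , q , t-lin =
  (app (lam a) [ t ] , app (lam p) (q ∷ [])) , app (lam a-lin) t-lin , 𝒯-βres-strictlyBelow p (q ∷ [])
𝒯-step-strict (lamβ d) with 𝒯-step-strict d
... | (s , p) , s-lin , below = (lam s , lam p) , lam s-lin , StrictlyBelow-map s≤s _ (λ _ → refl) below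
𝒯-step-strict (appL {N = N} d) with 𝒯-step-strict d | 𝒯-linear N
... | (s , p) , s-lin , below | t , q , t-lin =
  (app s [ t ] , app p (q ∷ [])) , app s-lin t-lin ,
  StrictlyBelow-map (suc-+ʳ-strictlyMonotone (sizes [ t ])) _ (λ _ → refl) below
𝒯-step-strict (appR {M = M} d) with 𝒯-linear M | 𝒯-step-strict d
... | s , p , s-lin | (t , q) , t-lin , below =
  (app s [ t ] , app p (q ∷ [])) , app s-lin t-lin ,
  StrictlyBelow-map (suc-+ˡ-strictlyMonotone (size s)) (bag-elem (s , p))
    (λ ys → cong (λ n → suc (size s + n)) (sizes-map-proj₁ ys))
    (prepend-StrictlyBelow (strict below) (single ≤-refl) (inj₁ below))
𝒯-step-strict (sumL d) with 𝒯-step-strict d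
... | (s , p) , s-lin , below = (s , sumL p) , s-lin , StrictlyBelow-map id _ (λ _ → refl) below
𝒯-step-strict (sumR d) with 𝒯-step-strict d
... | (s , p) , s-lin , below = (s , sumR p) , s-lin , StrictlyBelow-map id _ (λ _ → refl) below

-- A weight that decreases along every β-step

-- An object of weight n is worth more than n! objects of weight n - 1.
ω : ℕ → ℕ
ω zero = 1
ω (suc n) = suc (suc n ! * ω n)

ω-mono-≤ : ∀ {m n} → m ≤ n → ω m ≤ ω n
ω-mono-≤ = stepwise⇒monotone ω ω-step
  where
  ω-step : ∀ n → ω n ≤ ω (suc n)
  ω-step n = m≤n⇒m≤1+n (m≤n*m (ω n) (suc n !) {{suc n !≢0}})

Ω : (A → ℕ) → List A → ℕ
Ω w xs = sum (map (ω ∘ w) xs)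

module _ {w : A → ℕ} where

  Ω-++ : ∀ xs ys → Ω w (xs ++ ys) ≡ Ω w xs + Ω w ys
  Ω-++ xs ys = ≡-trans (cong sum (map-++ (ω ∘ w) xs ys)) (sum-++ (map (ω ∘ w) xs) (map (ω ∘ w) ys))

  Ω-≤-length* : ∀ xs k → (∀ x → x ∈ xs → w x ≤ k) → Ω w xs ≤ length xs * ω k
  Ω-≤-length* [] k w≤ = z≤n
  Ω-≤-length* (x ∷ xs) k w≤ = +-mono-≤ (ω-mono-≤ (w≤ x (here refl))) (Ω-≤-length* xs k (λ y → w≤ y ∘ there))

  StrictlyBelow⇒Ω< : ∀ {n xs} → StrictlyBelow w n xs → Ω w xs < ω n
  StrictlyBelow⇒Ω< {zero} {[]} _ = s≤s z≤n
  StrictlyBelow⇒Ω< {zero} {x ∷ xs} (w< , _) = ⊥-elim (n≮0 (w< x (here refl)))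
  StrictlyBelow⇒Ω< {suc n} {xs} (w< , length≤) = s≤s (begin
    Ω w xs                  ≤⟨ Ω-≤-length* xs n (λ x x∈ → ≤-pred (w< x x∈)) ⟩
    length xs * ω n         ≤⟨ *-monoˡ-≤ (ω n) length≤ ⟩
    suc n ! * ω n           ∎)
    where open ≤-Reasoning

  Below⇒Ω≤ : ∀ {n xs} → Below w n xs → Ω w xs ≤ ω n
  Below⇒Ω≤ (single w≤n) = ≤-trans (≤-reflexive (+-identityʳ _)) (ω-mono-≤ w≤n)
  Below⇒Ω≤ (strict below) = <⇒≤ (StrictlyBelow⇒Ω< below)

module _ {w : A → ℕ} {w' : B → ℕ} (f : A → List B) (f-≤ : ∀ x → Ω w' (f x) ≤ ω (w x)) where

  Ω-concatMap-≤ : ∀ xs → Ω w' (concatMap f xs) ≤ Ω w xs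
  Ω-concatMap-≤ [] = z≤n
  Ω-concatMap-≤ (x ∷ xs) = ≤-trans (≤-reflexive (Ω-++ (f x) (concatMap f xs))) (+-mono-≤ (f-≤ x) (Ω-concatMap-≤ xs))

  Ω-concatMap-< : ∀ {xs x} → x ∈ xs → Ω w' (f x) < ω (w x) → Ω w' (concatMap f xs) < Ω w xs
  Ω-concatMap-< {x ∷ xs} (here refl) f-< =
    ≤-trans (s≤s (≤-reflexive (Ω-++ (f x) (concatMap f xs)))) (+-mono-<-≤ f-< (Ω-concatMap-≤ xs))
  Ω-concatMap-< {y ∷ xs} (there x∈) f-< =
    ≤-trans (s≤s (≤-reflexive (Ω-++ (f y) (concatMap f xs)))) (+-mono-≤-< (f-≤ y) (Ω-concatMap-< x∈ f-<))

Covers : (M : Tm) → List (𝒯Elem M) → Set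
Covers M L = ∀ s (p : 𝒯 M s) → Up Linear s → (s , p) ∈ L

≃-elem : ∀ {M N} → M ≃ N → 𝒯Elem M → 𝒯Elem N
≃-elem e (s , p) = s , 𝒯-≃ e p

Ω-map-≃-elem : ∀ {M N} (e : M ≃ N) L → Ω elemSize (map (≃-elem e) L) ≡ Ω elemSize L
Ω-map-≃-elem e L = cong sum (sym (map-∘ L))

Covers-≃ : ∀ {M N} (e : M ≃ N) {L} → Covers M L → Covers N (map (≃-elem e) L)
Covers-≃ e {L} covers s p s-up =
  subst (λ q → (s , q) ∈ map (≃-elem e) L) (𝒯-≃-inverseʳ e p) (∈-map⁺ (≃-elem e) (covers s (𝒯-≃⁻ e p) s-up))

-- The preimage of a reduct above a linear term is above it too.
Covers-→β : ∀ {M N} (d : M →β N) {L} → Covers M L → Covers N (concatMap (𝒯-step d) L)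
Covers-→β d covers s p s-up with 𝒯-step-complete d (s , p)
... | (r , q) , p∈ = ∈-concatMap⁺′ (𝒯-step d) (covers r q (Up-upward (𝒯-step-sound d (r , q) p∈) s-up)) p∈

Covers-⇒β : ∀ {M N} → M ⇒β N → ∀ {L} → Covers M L →
            Σ (List (𝒯Elem N)) λ L' → Covers N L' × Ω elemSize L' < Ω elemSize L
Covers-⇒β (M' , N' , e , d , e') {L} covers =
  map (≃-elem e') L₂ , Covers-≃ e' covers₂ , (begin-strict
    Ω elemSize (map (≃-elem e') L₂) ≡⟨ Ω-map-≃-elem e' L₂ ⟩
    Ω elemSize L₂                   <⟨ Ω-concatMap-< (𝒯-step d) reducts-≤ (covers₁ s p (Up-inflationary s-lin)) reducts-< ⟩
    Ω elemSize L₁                   ≡⟨ Ω-map-≃-elem e L ⟩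
    Ω elemSize L                    ∎)
  where
  open ≤-Reasoning
  L₁ = map (≃-elem e) L
  covers₁ = Covers-≃ e covers
  L₂ = concatMap (𝒯-step d) L₁
  covers₂ = Covers-→β d covers₁
  reducts-≤ : ∀ x → Ω elemSize (𝒯-step d x) ≤ ω (elemSize x)
  reducts-≤ x = Below⇒Ω≤ (𝒯-step-Below d x)
  strict-elem = 𝒯-step-strict d
  s = proj₁ (proj₁ strict-elem)
  p = proj₂ (proj₁ strict-elem)
  s-lin = proj₁ (proj₂ strict-elem)
  reducts-< : Ω elemSize (𝒯-step d (s , p)) < ω (size s)
  reducts-< = StrictlyBelow⇒Ω< (proj₂ (proj₂ strict-elem))

finite⇒Covers : ∀ M → Finite (λ t → 𝒯 M t × Up Linear t) → Σ (List (𝒯Elem M)) (Covers M)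
finite⇒Covers M (ts , ts-complete) =
  concatMap elems ts , λ s p s-up → ∈-concatMap⁺′ elems (ts-complete s (p , s-up)) (∈-map⁺ (s ,_) (∈-derivations p))
  where
  elems : Res → List (𝒯Elem M)
  elems s = map (s ,_) (derivations M s)

ℕ-noInfiniteDescent : (f : ℕ → ℕ) → ¬ InfiniteDescendingSequence _<_ f
ℕ-noInfiniteDescent f descends =
  descent∧wf⇒empty {P = λ n → ∃ λ i → f i ≡ n} (λ { (i , refl) → f (suc i) , descends i , suc i , refl })
    <-wellFounded (f 0) (0 , refl)

finite-above-linear⇒SN : ∀ M → Finite (λ t → 𝒯 M t × Up Linear t) → StronglyNormalizable M
finite-above-linear⇒SN M finite (f , f0≃M , steps) = ℕ-noInfiniteDescent (Ω elemSize ∘ proj₁ ∘ cover) descends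
  where
  cover : ∀ i → Σ (List (𝒯Elem (f i))) (Covers (f i))
  cover zero with finite⇒Covers M finite
  ... | L , covers = map (≃-elem (≃-sym f0≃M)) L , Covers-≃ (≃-sym f0≃M) covers
  cover (suc i) with Covers-⇒β (steps i) (proj₂ (cover i))
  ... | L , covers , _ = L , covers
  descends : InfiniteDescendingSequence _<_ (Ω elemSize ∘ proj₁ ∘ cover)
  descends i = proj₂ (proj₂ (Covers-⇒β (steps i) (proj₂ (cover i))))

Linear⇒Bounded : ∀ {t} → Linear t → Bounded 1 t
Linear⇒Bounded var = var
Linear⇒Bounded (lam t-lin) = lam (Linear⇒Bounded t-lin)
Linear⇒Bounded (app s-lin t-lin) = app (Linear⇒Bounded s-lin) (Linear⇒Bounded t-lin ∷ []) ≤-refl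

𝔏⊆𝔅 : 𝔏 ⊆ˢ 𝔅
𝔏⊆𝔅 a a-linear = 1 , λ t t∈a → Linear⇒Bounded (a-linear t t∈a)

-- The set of all linear terms belongs to 𝔏, hence to 𝔗.
InPerpUp⇒SN : (𝔗 : Structure) → 𝔏 ⊆ˢ 𝔗 → (M : Tm) → InPerpUp 𝔗 (𝒯 M) → StronglyNormalizable M
InPerpUp⇒SN 𝔗 𝔏⊆𝔗 M perp = finite-above-linear⇒SN M (perp Linear (𝔏⊆𝔗 Linear (λ _ t-lin → t-lin)))

theorem5 : ((𝔗 : Structure) → 𝔏 ⊆ˢ 𝔗 → (M : Tm) →
             InPerpUp 𝔗 (𝒯 M) → StronglyNormalizable M)
           × ((M : Tm) → InPerpUp 𝔏 (𝒯 M) → StronglyNormalizable M)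
           × ((M : Tm) → InPerpUp 𝔅 (𝒯 M) → StronglyNormalizable M)
theorem5 = InPerpUp⇒SN , InPerpUp⇒SN 𝔏 (λ _ a∈𝔏 → a∈𝔏) , InPerpUp⇒SN 𝔅 𝔏⊆𝔅
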